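{- Let $S$ and $S'$ be histories such that $S'$ is obtained from $S$ by deleting some (possibly no) call actions, and suppose $S$ and $S'$ are balanced from footprints $l_1$ and $l_2$ respectively, with $l_2\preceq l_1$. Then the $\circ$-combination $l_c$ of the footprints $\delta(\sigma)$ of the states $\sigma$ transferred at the deleted call actions of $S$ is defined ($l_c=\delta(e)$ if none are deleted), $S'$ is balanced from $l_1$, and $[\![S]\!]^\sharp l_1=([\![S']\!]^\sharp l_1)\circ l_c$ and $[\![S']\!]^\sharp l_2\preceq[\![S']\!]^\sharp l_1$.
   Context: $\Sigma$ is a set with a partial binary operation $*$, commutative and associative (both sides defined and equal or both undefined), cancellative, with unit $e$. Footprint $\delta(\sigma)=\{\sigma'\mid\forall\sigma''.\,(\sigma'*\sigma'')\text{ defined}\iff(\sigma*\sigma'')\text{ defined}\}$. For footprints, $\delta(\sigma_1)\circ\delta(\sigma_2)=\delta(\sigma_1*\sigma_2)$ if $\sigma_1*\sigma_2$ is defined, undefined otherwise. Standing assumption: $*$ is cancellative on footprints (whenever $\sigma_1*\sigma_2$, $\sigma_1'*\sigma_2'$ are defined, $\delta(\sigma_1*\sigma_2)=\delta(\sigma_1'*\sigma_2')$ and $\delta(\sigma_1)=\delta(\sigma_1')$ imply $\delta(\sigma_2)=\delta(\sigma_2')$). $l_2\mathbin{\backslash\!\backslash}l_1=\delta(\sigma)$ if $l_1=\delta(\sigma_1),l_2=\delta(\sigma_2),\sigma_2=\sigma_1*\sigma$ for some states, undefined otherwise; $l_1\preceq l_2$ iff $l_2\mathbin{\backslash\!\backslash}l_1$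 is defined. An interface action is $(t,\mathsf{call}\ m(\sigma))$ or $(t,\mathsf{ret}\ m(\sigma))$ ($t$ thread, $m$ method, $\sigma$ the transferred state). A history is a finite sequence of interface actions whose projection to each thread alternates calls and returns of matching methods, starting with a call. $[\![\varepsilon]\!]^\sharp l=l$; $[\![H\psi]\!]^\sharp l=([\![H]\!]^\sharp l)\circ\delta(\sigma)$ for a call carrying $\sigma$ and $([\![H]\!]^\sharp l)\mathbin{\backslash\!\backslash}\delta(\sigma)$ for a return carrying $\sigma$ (undefined if anything is undefined). $H$ is balanced from $l$ if $[\![H]\!]^\sharp l$ is defined. -}

module Defs where

open import Data.Maybe using (Maybe; just; nothing; _>>=_)
open import Data.Product using (Σ; ∃; ∃-syntax; _×_; _,_)
open import Data.List using (List; []; _∷_)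
open import Relation.Binary.PropositionalEquality using (_≡_; _≢_)
open import Function.Bundles using (_⇔_)

record PCM : Set₁ where
  field
    State : Set
    _*_   : State → State → Maybe State
    e     : State
  Defined : Maybe State → Set
  Defined m = ∃[ s ] (m ≡ just s)
  -- σ' ∈ δ(σ): σ' and σ are compatible with exactly the same states.
  -- Footprints are represented by representatives; δ σ ≃ δ σ' is  σ ≃ σ'.
  _≃_ : State → State → Set
  σ' ≃ σ = ∀ σ'' → Defined (σ' * σ'') ⇔ Defined (σ * σ'')
  field
    *-comm   : ∀ a b → a * b ≡ b * a
    *-assoc  : ∀ a b c → ((a * b) >>= λ ab → ab * c) ≡ ((b * c) >>= λ bc → a * bc)
    *-unit   : ∀ a → a * e ≡ just a
    *-cancel : ∀ a b c d → a * b ≡ just d → a * c ≡ just d → b ≡ c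
    *-fp-cancel : ∀ s₁ s₂ s₁' s₂' s s' → s₁ * s₂ ≡ just s → s₁' * s₂' ≡ just s' →
                  s ≃ s' → s₁ ≃ s₁' → s₂ ≃ s₂'

module Histories (A : PCM) (Thread Method : Set) where
  open PCM A

  -- A footprint, given by a representative state l (standing for δ(l)).
  Footprint : Set
  Footprint = State

  Comp : Footprint → Footprint → Footprint → Set
  Comp l₁ l₂ l = ∃[ σ₁ ] ∃[ σ₂ ] ∃[ σ ]
    (σ₁ ≃ l₁ × σ₂ ≃ l₂ × σ₁ * σ₂ ≡ just σ × σ ≃ l)

  Diff : Footprint → Footprint → Footprint → Set
  Diff l₂ l₁ l = ∃[ σ₁ ] ∃[ σ₂ ] ∃[ σ ]
    (l₁ ≃ σ₁ × l₂ ≃ σ₂ × σ₁ * σ ≡ just σ₂ × l ≃ σ)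

  _⪯_ : Footprint → Footprint → Set
  l₁ ⪯ l₂ = ∃[ l ] Diff l₂ l₁ l

  data Kind : Set where
    call ret : Kind

  record Action : Set where
    constructor act
    field
      thread : Thread
      kind   : Kind
      method : Method
      state  : State

  History = List Action

  data Status : Set where
    idle : Status
    busy : Method → Status

  -- per-thread projection alternates call m / ret m, starting with a call
  data ThreadOK (t : Thread) : Status → List Action → Set where
    nil   : ∀ {s} → ThreadOK t s []
    other : ∀ {s t' k m σ H} → t' ≢ t → ThreadOK t s H →
            ThreadOK t s (act t' k m σ ∷ H)
    cal   : ∀ {m σ H} → ThreadOK t (busy m) H →
            ThreadOK t idle (act t call m σ ∷ H)
    rt    : ∀ {m σ H} → ThreadOK t idle H →
            ThreadOK t (busy m) (act t ret m σ ∷ H)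

  IsHistory : List Action → Set
  IsHistory H = ∀ t → ThreadOK t idle H

  Step : Action → Footprint → Footprint → Set
  Step (act _ call _ σ) l l' = Comp l σ l'
  Step (act _ ret  _ σ) l l' = Diff l σ l'

  -- Eval H l l' : ⟦H⟧♯ l is defined and equals l'
  -- (⟦ψ H⟧♯ l = ⟦H⟧♯ (⟦ψ⟧♯ l), i.e. the left-fold semantics)
  data Eval : List Action → Footprint → Footprint → Set where
    done : ∀ {l l'} → l' ≃ l → Eval [] l l'
    step : ∀ {a H l m l'} → Step a l m → Eval H m l' → Eval (a ∷ H) l l'

  Balanced : List Action → Footprint → Set
  Balanced H l = ∃[ l' ] Eval H l l'

  data DeleteCalls : List Action → List Action → List State → Set where
    []   : DeleteCalls [] [] []
    keep : ∀ {a S S' ds} → DeleteCalls S S' ds → DeleteCalls (a ∷ S) (a ∷ S') ds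
    drop : ∀ {t m σ S S' ds} → DeleteCalls S S' ds →
           DeleteCalls (act t call m σ ∷ S) S' (σ ∷ ds)

  Combine : List State → Footprint → Set
  Combine []       l = l ≃ e
  Combine (σ ∷ ds) l = ∃[ m ] (Combine ds m × Comp σ m l)

-- Along S the footprint is always the footprint along S' composed with the
-- states of the calls deleted so far; a kept call or return acts on both sides
-- and commutes past that extra part by associativity, and a deleted call merely
-- enlarges it.  Returns of S' are possible from l₁ because they are possible
-- from the smaller l₂, and the slack l₁ \\ l₂ is carried along in the same way,
-- which gives the monotonicity part.

module Submission where

open import Defs
open import Data.Product using (∃; ∃-syntax; _×_; _,_)
open import Data.List using (List)
open import Data.Maybe using (Maybe; just; nothing; _>>=_)
open import Data.Maybe.Properties using (just-injective)
open import Relation.Binary.PropositionalEquality using (_≡_; refl; sym; trans; cong; subst)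
open import Level using (0ℓ)
open import Relation.Binary.Structures using (IsEquivalence)
open import Function.Bundles using (mk⇔; module Equivalence)
open import Function.Properties.Equivalence using (⇔-isEquivalence)

module FootprintCalculus (A : PCM) (Thread Method : Set) where
  open PCM A
  open Histories A Thread Method
  open Equivalence using (to)
  open IsEquivalence (⇔-isEquivalence {ℓ = 0ℓ}) using ()
    renaming (refl to ⇔-refl; sym to ⇔-sym; trans to ⇔-trans)

  -- A record around _≃_, so that its two endpoints can be inferred by unification.
  record _≈_ (a b : State) : Set where
    constructor ⟨_⟩
    field ≈⇒≃ : a ≃ b
  open _≈_

  ≈-refl : ∀ {a} → a ≈ a
  ≈-refl = ⟨ (λ _ → ⇔-refl) ⟩

  ≈-sym : ∀ {a b} → a ≈ b → b ≈ a
  ≈-sym ⟨ p ⟩ = ⟨ (λ x → ⇔-sym (p x)) ⟩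

  ≈-trans : ∀ {a b c} → a ≈ b → b ≈ c → a ≈ c
  ≈-trans ⟨ p ⟩ ⟨ q ⟩ = ⟨ (λ x → ⇔-trans (p x) (q x)) ⟩

  _∙_↦_ : State → State → State → Set
  a ∙ b ↦ c = a * b ≡ just c

  ∙-functional : ∀ {a b c c'} → a ∙ b ↦ c → a ∙ b ↦ c' → c ≡ c'
  ∙-functional p q = just-injective (trans (sym p) q)

  ∙-comm : ∀ {a b c} → a ∙ b ↦ c → b ∙ a ↦ c
  ∙-comm {a} {b} p = trans (*-comm b a) p

  >>=-just : ∀ (m : Maybe State) (f : State → Maybe State) {d} →
             (m >>= f) ≡ just d → ∃[ y ] (m ≡ just y × f y ≡ just d)
  >>=-just (just y) f h = y , refl , h
  >>=-just nothing  f ()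

  ∙-assoc : ∀ {a b c x d} → a ∙ b ↦ c → c ∙ x ↦ d → ∃[ y ] (b ∙ x ↦ y × a ∙ y ↦ d)
  ∙-assoc {a} {b} {c} {x} p q =
    >>=-just (b * x) (a *_)
      (trans (sym (*-assoc a b x)) (trans (cong (_>>= _* x) p) q))

  ∙-assoc⁻ : ∀ {a b x y d} → b ∙ x ↦ y → a ∙ y ↦ d → ∃[ c ] (a ∙ b ↦ c × c ∙ x ↦ d)
  ∙-assoc⁻ {a} {b} {x} p q =
    >>=-just (a * b) (_* x)
      (trans (*-assoc a b x) (trans (cong (_>>= a *_) p) q))

  ∙-defined-congˡ : ∀ {a a' b c c' x} → a ≈ a' → a ∙ b ↦ c → a' ∙ b ↦ c' →
                    Defined (c * x) → Defined (c' * x)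
  ∙-defined-congˡ {x = x} a≈a' ab ab' (d , cx) with ∙-assoc ab cx
  ... | y , bx , ay with to (≈⇒≃ a≈a' y) (d , ay)
  ... | d' , a'y with ∙-assoc⁻ bx a'y
  ... | c'' , a'b , c''x = d' , subst (λ z → z ∙ x ↦ d') (∙-functional a'b ab') c''x

  ∙-congˡ : ∀ {a a' b c} → a ≈ a' → a ∙ b ↦ c → ∃[ c' ] (a' ∙ b ↦ c' × c ≈ c')
  ∙-congˡ {b = b} a≈a' ab with to (≈⇒≃ a≈a' b) (_ , ab)
  ... | c' , a'b = c' , a'b ,
        ⟨ (λ _ → mk⇔ (∙-defined-congˡ a≈a' ab a'b) (∙-defined-congˡ (≈-sym a≈a') a'b ab)) ⟩

  ∙-cong : ∀ {a a' b b' c} → a ≈ a' → b ≈ b' → a ∙ b ↦ c → ∃[ c' ] (a' ∙ b' ↦ c' × c ≈ c')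
  ∙-cong a≈a' b≈b' ab with ∙-congˡ a≈a' ab
  ... | c₁ , a'b , c≈c₁ with ∙-congˡ b≈b' (∙-comm a'b)
  ... | c₂ , b'a' , c₁≈c₂ = c₂ , ∙-comm b'a' , ≈-trans c≈c₁ c₁≈c₂

  ∙⇒Comp : ∀ {a b c} → a ∙ b ↦ c → Comp a b c
  ∙⇒Comp p = _ , _ , _ , ≈⇒≃ ≈-refl , ≈⇒≃ ≈-refl , p , ≈⇒≃ ≈-refl

  Comp⇒∙ : ∀ {a b c} → Comp a b c → ∃[ c' ] (a ∙ b ↦ c' × c' ≈ c)
  Comp⇒∙ (_ , _ , _ , σ₁≃a , σ₂≃b , p , σ≃c) with ∙-cong ⟨ σ₁≃a ⟩ ⟨ σ₂≃b ⟩ p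
  ... | c' , ab , σ≈c' = c' , ab , ≈-trans (≈-sym σ≈c') ⟨ σ≃c ⟩

  Comp-cong : ∀ {a a' b b' c c'} → a ≈ a' → b ≈ b' → c ≈ c' → Comp a b c → Comp a' b' c'
  Comp-cong a≈a' b≈b' c≈c' (σ₁ , σ₂ , σ , σ₁≃a , σ₂≃b , p , σ≃c) =
    σ₁ , σ₂ , σ , ≈⇒≃ (≈-trans ⟨ σ₁≃a ⟩ a≈a') , ≈⇒≃ (≈-trans ⟨ σ₂≃b ⟩ b≈b') ,
    p , ≈⇒≃ (≈-trans ⟨ σ≃c ⟩ c≈c')

  Comp-comm : ∀ {a b c} → Comp a b c → Comp b a c
  Comp-comm (σ₁ , σ₂ , σ , σ₁≃a , σ₂≃b , p , σ≃c) = σ₂ , σ₁ , σ , σ₂≃b , σ₁≃a , ∙-comm p , σ≃c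

  Comp-functional : ∀ {a b c c'} → Comp a b c → Comp a b c' → c ≈ c'
  Comp-functional p q =
    let (u , ab↦u , u≈c) = Comp⇒∙ p
        (v , ab↦v , v≈c') = Comp⇒∙ q
    in ≈-trans (≈-sym u≈c) (subst (_≈ _) (sym (∙-functional ab↦u ab↦v)) v≈c')

  Comp-identityʳ : ∀ {a} → Comp a e a
  Comp-identityʳ {a} = ∙⇒Comp (*-unit a)

  Comp-assoc : ∀ {a b ab c abc} → Comp a b ab → Comp ab c abc →
               ∃[ bc ] (Comp b c bc × Comp a bc abc)
  Comp-assoc p q =
    let (u , a∙b , u≈ab) = Comp⇒∙ p
        (v , ab∙c , v≈abc) = Comp⇒∙ q
        (v' , u∙c , v≈v') = ∙-congˡ (≈-sym u≈ab) ab∙c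
        (y , b∙c , a∙y) = ∙-assoc a∙b u∙c
    in y , ∙⇒Comp b∙c , Comp-cong ≈-refl ≈-refl (≈-trans (≈-sym v≈v') v≈abc) (∙⇒Comp a∙y)

  Comp-assoc⁻ : ∀ {a b c bc abc} → Comp b c bc → Comp a bc abc →
                ∃[ ab ] (Comp a b ab × Comp ab c abc)
  Comp-assoc⁻ p q =
    let (ba , cb , cba) = Comp-assoc (Comp-comm p) (Comp-comm q)
    in ba , Comp-comm cb , Comp-comm cba

  Comp-cancelˡ : ∀ {a b b' c} → Comp a b c → Comp a b' c → b ≈ b'
  Comp-cancelˡ {a} {b} {b'} p q =
    let (u , ab↦u , u≈c) = Comp⇒∙ p
        (v , ab'↦v , v≈c) = Comp⇒∙ q
    in ⟨ *-fp-cancel a b a b' u v ab↦u ab'↦v (≈⇒≃ (≈-trans u≈c (≈-sym v≈c))) (≈⇒≃ ≈-refl) ⟩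

  Diff⇒Comp : ∀ {l₂ l₁ l} → Diff l₂ l₁ l → Comp l₁ l l₂
  Diff⇒Comp (σ₁ , σ₂ , σ , l₁≃σ₁ , l₂≃σ₂ , p , l≃σ) =
    σ₁ , σ , σ₂ , ≈⇒≃ (≈-sym ⟨ l₁≃σ₁ ⟩) , ≈⇒≃ (≈-sym ⟨ l≃σ ⟩) , p , ≈⇒≃ (≈-sym ⟨ l₂≃σ₂ ⟩)

  Comp⇒Diff : ∀ {l₂ l₁ l} → Comp l₁ l l₂ → Diff l₂ l₁ l
  Comp⇒Diff (σ₁ , σ , σ₂ , σ₁≃l₁ , σ≃l , p , σ₂≃l₂) =
    σ₁ , σ₂ , σ , ≈⇒≃ (≈-sym ⟨ σ₁≃l₁ ⟩) , ≈⇒≃ (≈-sym ⟨ σ₂≃l₂ ⟩) , p , ≈⇒≃ (≈-sym ⟨ σ≃l ⟩)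

  Step-congˡ : ∀ a {l l' n} → l ≈ l' → Step a l n → Step a l' n
  Step-congˡ (act _ call _ _) l≈l' s = Comp-cong l≈l' ≈-refl ≈-refl s
  Step-congˡ (act _ ret  _ _) l≈l' s = Comp⇒Diff (Comp-cong ≈-refl ≈-refl l≈l' (Diff⇒Comp s))

  Step-functional : ∀ a {l n n'} → Step a l n → Step a l n' → n ≈ n'
  Step-functional (act _ call _ _) s s' = Comp-functional s s'
  Step-functional (act _ ret  _ _) s s' = Comp-cancelˡ (Diff⇒Comp s) (Diff⇒Comp s')

  Eval-congˡ : ∀ {H l l' r} → l ≈ l' → Eval H l r → Eval H l' r
  Eval-congˡ l≈l' (done r≃l)         = done (≈⇒≃ (≈-trans ⟨ r≃l ⟩ l≈l'))
  Eval-congˡ l≈l' (step {a = a} s ev) = step (Step-congˡ a l≈l' s) ev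

  Eval-functional : ∀ {H l r r'} → Eval H l r → Eval H l r' → r ≈ r'
  Eval-functional (done r≃l) (done r'≃l) = ≈-trans ⟨ r≃l ⟩ (≈-sym ⟨ r'≃l ⟩)
  Eval-functional (step {a = a} s ev) (step s' ev') =
    Eval-functional ev (Eval-congˡ (≈-sym (Step-functional a s s')) ev')

  record Simulation (ds : List State) (S' : History) (r₁ p r a : Footprint) : Set where
    constructor simulation
    field
      lc q r'      : Footprint
      combine      : Combine ds lc
      p∘lc         : Comp p lc q
      eval-from-r₁ : Eval S' r₁ r'
      r'∘q         : Comp r' q r
      a⪯r'         : ∃[ y ] Comp a y r'

  -- Invariant: S is run from r₁ ∘ p, where p composes the calls deleted so far,
  -- and S' from r₂ with r₂ ∘ x = r₁.
  simulate : ∀ {S S' ds} → DeleteCalls S S' ds → ∀ {m r₁ r₂ p x r a} →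
             Comp r₁ p m → Comp r₂ x r₁ → Eval S m r → Eval S' r₂ a →
             Simulation ds S' r₁ p r a
  simulate [] {p = p} {x} r₁∘p r₂∘x (done r≃m) (done a≃r₂) =
    simulation e p _ (≈⇒≃ ≈-refl) Comp-identityʳ (done (≈⇒≃ ≈-refl))
      (Comp-cong ≈-refl ≈-refl (≈-sym ⟨ r≃m ⟩) r₁∘p)
      (x , Comp-cong (≈-sym ⟨ a≃r₂ ⟩) ≈-refl ≈-refl r₂∘x)
  simulate (keep {a = act _ call _ σ} d) r₁∘p r₂∘x (step m∘σ ev) (step r₂∘σ ev') =
    let (y , r₁∘σ , p∘y) = Comp-assoc (Comp-comm r₁∘p) m∘σ
        (w , x∘σ , r₂∘w) = Comp-assoc r₂∘x r₁∘σ
        (t , r₂∘σ' , t∘x) = Comp-assoc⁻ (Comp-comm x∘σ) r₂∘w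
        simulation lc q r' combine p∘lc eval r'∘q a⪯r' = simulate d (Comp-comm p∘y)
          (Comp-cong (Comp-functional r₂∘σ' r₂∘σ) ≈-refl ≈-refl t∘x) ev ev'
    in simulation lc q r' combine p∘lc (step r₁∘σ eval) r'∘q a⪯r'
  simulate (keep {a = act _ ret _ σ} d) r₁∘p r₂∘x (step m\\σ ev) (step r₂\\σ ev') =
    let (w , a₁∘x , σ∘w) = Comp-assoc (Diff⇒Comp r₂\\σ) r₂∘x
        (v , w∘p , σ∘v) = Comp-assoc σ∘w r₁∘p
        simulation lc q r' combine p∘lc eval r'∘q a⪯r' = simulate d
          (Comp-cong ≈-refl ≈-refl (Comp-cancelˡ σ∘v (Diff⇒Comp m\\σ)) w∘p) a₁∘x ev ev'
    in simulation lc q r' combine p∘lc (step (Comp⇒Diff σ∘w) eval) r'∘q a⪯r'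
  simulate (drop d) r₁∘p r₂∘x (step m∘σ ev) ev' =
    let (p' , p∘σ , r₁∘p') = Comp-assoc r₁∘p m∘σ
        simulation lc q r' combine p'∘lc eval r'∘q a⪯r' = simulate d r₁∘p' r₂∘x ev ev'
        (lc' , σ∘lc , p∘lc') = Comp-assoc p∘σ p'∘lc
    in simulation lc' q r' (lc , combine , σ∘lc) p∘lc' eval r'∘q a⪯r'

proposition7p7 : (A : PCM) (Thread Method : Set) →
    let open PCM A in let open Histories A Thread Method in
    (S S' : List Action) (ds : List State) (l₁ l₂ : Footprint) →
    IsHistory S → IsHistory S' → DeleteCalls S S' ds →
    Balanced S l₁ → Balanced S' l₂ → l₂ ⪯ l₁ →
    ∃[ lc ] (Combine ds lc
    × Balanced S' l₁
    × (∀ r r' → Eval S l₁ r → Eval S' l₁ r' → Comp r' lc r)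
    × (∀ r₂ r₁ → Eval S' l₂ r₂ → Eval S' l₁ r₁ → r₂ ⪯ r₁))
proposition7p7 A Thread Method S S' ds l₁ l₂ _ _ d (r , evalS) (a , evalS') (_ , l₁\\l₂) =
  lc , combine , (r' , eval-from-r₁) ,
  (λ _ _ evalS″ evalS'″ →
    Comp-cong (Eval-functional eval-from-r₁ evalS'″)
              (Comp-functional p∘lc (Comp-comm Comp-identityʳ))
              (Eval-functional evalS evalS″) r'∘q) ,
  (λ _ _ evalS'₂ evalS'₁ → let (y , a∘y) = a⪯r' in
    y , Comp⇒Diff (Comp-cong (Eval-functional evalS' evalS'₂) ≈-refl
                              (Eval-functional eval-from-r₁ evalS'₁) a∘y))
  where
  open FootprintCalculus A Thread Method
  open Simulation (simulate d Comp-identityʳ (Diff⇒Comp l₁\\l₂) evalS evalS')
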